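{- Let $G_1,G_2$ be finite simple connected graphs, $G_i$ having $n_i$ vertices and $m_i$ edges. Then the composition $G_1[G_2]$ satisfies \[F(G_1[G_2])=n_2^4F(G_1)+n_1F(G_2)+6n_2^2m_2M_1(G_1)+6n_2m_1M_1(G_2).\]
   Context: The composition (lexicographic product) $G_1[G_2]$ has vertex set $V(G_1)\times V(G_2)$, with $(u_1,u_2)$ adjacent to $(v_1,v_2)$ iff $u_1v_1\in E(G_1)$, or [$u_1=v_1$ and $u_2v_2\in E(G_2)$]. For a finite simple graph $G$ with vertex degrees $d_G(v)$: $M_1(G)=\sum_{v} d_G(v)^2$ and $F(G)=\sum_{v} d_G(v)^3$. -}

module Defs where

open import Data.Nat using (ℕ; zero; suc; _+_; _*_; _^_)
open import Data.Fin using (Fin; remQuot; _<_)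
open import Data.Bool using (Bool; true; false; _∨_; _∧_; if_then_else_)
open import Data.Product using (_×_; _,_; proj₁; proj₂; ∃)
open import Data.List using (List; []; _∷_; map; allFin)
open import Data.Nat.ListAction using (sum)
open import Relation.Binary.PropositionalEquality using (_≡_)
open import Relation.Nullary using (¬_)
open import Relation.Nullary.Decidable using (⌊_⌋)
open import Data.Fin.Properties using (_≟_; _<?_)

record Graph (n : ℕ) : Set where
  field
    adj     : Fin n → Fin n → Bool
    symm    : ∀ u v → adj u v ≡ adj v u
    irrefl  : ∀ v → adj v v ≡ false
open Graph public

Σv : ∀ {n} → (Fin n → ℕ) → ℕ
Σv {n} f = sum (map f (allFin n))

b2n : Bool → ℕ
b2n true  = 1
b2n false = 0

deg : ∀ {n} → Graph n → Fin n → ℕ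
deg G u = Σv (λ v → b2n (adj G u v))

edges : ∀ {n} → Graph n → ℕ
edges G = Σv (λ u → Σv (λ v → b2n (⌊ u <? v ⌋ ∧ adj G u v)))

M₁ : ∀ {n} → Graph n → ℕ
M₁ G = Σv (λ v → deg G v ^ 2)

F : ∀ {n} → Graph n → ℕ
F G = Σv (λ v → deg G v ^ 3)

data Walk {n} (G : Graph n) : Fin n → Fin n → Set where
  here : ∀ {u} → Walk G u u
  step : ∀ {u v w} → adj G u v ≡ true → Walk G v w → Walk G u w

Connected : ∀ {n} → Graph n → Set
Connected G = ∀ u v → Walk G u v

-- composition (lexicographic product) G₁[G₂] on Fin (n₁ * n₂),
-- with vertex x identified with the pair remQuot n₂ x ∈ Fin n₁ × Fin n₂
-- (a bijection Fin (n₁ * n₂) ≃ Fin n₁ × Fin n₂, inverse of Data.Fin.combine).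
compAdj : ∀ {n₁ n₂} → Graph n₁ → Graph n₂ → Fin n₁ × Fin n₂ → Fin n₁ × Fin n₂ → Bool
compAdj G₁ G₂ (u₁ , u₂) (v₁ , v₂) =
  adj G₁ u₁ v₁ ∨ (⌊ u₁ ≟ v₁ ⌋ ∧ adj G₂ u₂ v₂)

private
  open import Relation.Binary.PropositionalEquality using (refl; cong₂)
  open import Data.Bool.Properties using (∧-zeroʳ)
  open import Relation.Nullary using (yes; no)

  compSymm : ∀ {n₁ n₂} (G₁ : Graph n₁) (G₂ : Graph n₂) a b →
             compAdj G₁ G₂ a b ≡ compAdj G₁ G₂ b a
  compSymm G₁ G₂ (u₁ , u₂) (v₁ , v₂) with u₁ ≟ v₁ | v₁ ≟ u₁
  ... | yes p | yes q = cong₂ _∨_ (symm G₁ u₁ v₁) (cong₂ _∧_ refl (symm G₂ u₂ v₂))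
  ... | yes refl | no q with () ← q refl
  ... | no p | yes refl with () ← p refl
  ... | no p | no q = cong₂ _∨_ (symm G₁ u₁ v₁) refl

  compIrrefl : ∀ {n₁ n₂} (G₁ : Graph n₁) (G₂ : Graph n₂) a →
               compAdj G₁ G₂ a a ≡ false
  compIrrefl G₁ G₂ (u₁ , u₂) with u₁ ≟ u₁
  ... | yes _ rewrite irrefl G₁ u₁ | irrefl G₂ u₂ = refl
  ... | no p with () ← p refl

_[_] : ∀ {n₁ n₂} → Graph n₁ → Graph n₂ → Graph (n₁ * n₂)
_[_] {n₁} {n₂} G₁ G₂ = record
  { adj    = λ x y → compAdj G₁ G₂ (remQuot n₂ x) (remQuot n₂ y)
  ; symm   = λ x y → compSymm G₁ G₂ (remQuot n₂ x) (remQuot n₂ y)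
  ; irrefl = λ x → compIrrefl G₁ G₂ (remQuot n₂ x)
  }

module Submission where

-- Write d₁, d₂ for the degree functions of G₁ and G₂.  A vertex
-- (u₁ , u₂) of G₁[G₂] is adjacent to the whole fibre {v₁} × V(G₂) for each
-- neighbour v₁ of u₁, and to (u₁ , v₂) for each neighbour v₂ of u₂, so its
-- degree is  n₂·d₁(u₁) + d₂(u₂).  Hence
--   F(G₁[G₂]) = Σ_{u₁,u₂} (n₂·d₁(u₁) + d₂(u₂))³,
-- and expanding the cube (twice, using that Σ_v a(v)^k are just numbers)
-- gives  n₂⁴F(G₁) + 3n₂²(Σd₂)M₁(G₁) + 3n₂(Σd₁)M₁(G₂) + n₁F(G₂).
-- The handshake lemma Σd = 2m finishes the computation.

open import Defs
open import Data.Nat using (ℕ; zero; suc; _+_; _*_; _^_)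
open import Data.Nat.Properties using (+-*-semiring; +-assoc; +-identityʳ; *-identityˡ; *-zeroʳ)
open import Data.Nat.Solver using (module +-*-Solver)
import Data.Nat.ListAction as List
open import Data.Fin using (Fin; zero; suc; splitAt; quotRem; remQuot; quotient; remainder)
open import Data.Fin.Properties using (_≟_; _<?_; <-cmp; <-asym)
open import Data.Bool using (true; false; _∨_; _∧_)
open import Data.Bool.Properties using (∨-identityʳ)
open import Data.Product using (_×_; _,_; proj₁; proj₂; swap; map₂)
open import Data.Sum using (_⊎_; inj₁; inj₂; [_,_]′; map₁)
open import Function using (_∘_)
open import Data.List using (tabulate)
open import Data.List.Properties using (map-tabulate)
open import Data.Empty using (⊥-elim)
open import Relation.Nullary using (yes; no)
open import Relation.Nullary.Decidable using (⌊_⌋; ⌊⌋-map′)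
open import Relation.Binary.Definitions using (tri<; tri≈; tri>)
open import Relation.Binary.PropositionalEquality
  using (_≡_; refl; sym; trans; cong; cong₂; module ≡-Reasoning)
open import Algebra.Properties.Semiring.Sum +-*-semiring
  using (sum; sum-syntax; sum-cong-≗; sum-replicate-zero; ∑-distrib-+; ∑-comm;
         *-distribˡ-sum)

open ≡-Reasoning

sum-tabulate : ∀ {n} (f : Fin n → ℕ) → List.sum (tabulate f) ≡ sum f
sum-tabulate {zero}  f = refl
sum-tabulate {suc n} f = cong (f zero +_) (sum-tabulate (λ i → f (suc i)))

Σv≡∑ : ∀ {n} (f : Fin n → ℕ) → Σv f ≡ sum f
Σv≡∑ f = trans (cong List.sum (map-tabulate (λ i → i) f)) (sum-tabulate f)

∑-const : ∀ n (c : ℕ) → ∑[ _ < n ] c ≡ n * c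
∑-const zero    c = refl
∑-const (suc n) c = cong (c +_) (∑-const n c)

∑-delta : ∀ {n} (u : Fin n) (c : ℕ) → ∑[ i < n ] (b2n ⌊ u ≟ i ⌋ * c) ≡ c
∑-delta {suc n} zero    c =
  trans (cong (c + 0 +_) (sum-replicate-zero n)) (trans (+-identityʳ _) (+-identityʳ c))
∑-delta {suc n} (suc u) c =
  trans (sum-cong-≗ (λ i → cong (λ b → b2n b * c) (⌊⌋-map′ _ _ (u ≟ i)))) (∑-delta u c)

∑-cubic : ∀ {n} (x : Fin n → ℕ) (p₃ p₂ p₁ p₀ : ℕ) →
  ∑[ i < n ] (p₃ * x i ^ 3 + p₂ * x i ^ 2 + p₁ * x i + p₀)
    ≡ p₃ * ∑[ i < n ] (x i ^ 3) + p₂ * ∑[ i < n ] (x i ^ 2) + p₁ * sum x + n * p₀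
∑-cubic {n} x p₃ p₂ p₁ p₀ = begin
  ∑[ i < n ] (t₃ i + t₂ i + t₁ i + p₀)
    ≡⟨ ∑-distrib-+ (λ i → t₃ i + t₂ i + t₁ i) (λ _ → p₀) ⟩
  ∑[ i < n ] (t₃ i + t₂ i + t₁ i) + ∑[ _ < n ] p₀
    ≡⟨ cong₂ _+_ (∑-distrib-+ (λ i → t₃ i + t₂ i) t₁) (∑-const n p₀) ⟩
  ∑[ i < n ] (t₃ i + t₂ i) + sum t₁ + n * p₀
    ≡⟨ cong (λ s → s + sum t₁ + n * p₀) (∑-distrib-+ t₃ t₂) ⟩
  sum t₃ + sum t₂ + sum t₁ + n * p₀
    ≡⟨ cong₂ (λ s r → s + r + n * p₀)
         (cong₂ _+_ (sym (*-distribˡ-sum p₃ (λ i → x i ^ 3)))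
                    (sym (*-distribˡ-sum p₂ (λ i → x i ^ 2))))
         (sym (*-distribˡ-sum p₁ x)) ⟩
  p₃ * ∑[ i < n ] (x i ^ 3) + p₂ * ∑[ i < n ] (x i ^ 2) + p₁ * sum x + n * p₀ ∎
  where
  t₃ t₂ t₁ : Fin n → ℕ
  t₃ i = p₃ * x i ^ 3
  t₂ i = p₂ * x i ^ 2
  t₁ i = p₁ * x i

∑-shifted-cube : ∀ {n} (c : ℕ) (b : Fin n → ℕ) →
  ∑[ j < n ] ((c + b j) ^ 3)
    ≡ 1 * ∑[ j < n ] (b j ^ 3) + 3 * c * ∑[ j < n ] (b j ^ 2) + 3 * c ^ 2 * sum b + n * c ^ 3
∑-shifted-cube c b =
  trans (sum-cong-≗ (λ j → binomial c (b j))) (∑-cubic b 1 (3 * c) (3 * c ^ 2) (c ^ 3))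
  where
  open +-*-Solver
  binomial : ∀ c y → (c + y) ^ 3 ≡ 1 * y ^ 3 + 3 * c * y ^ 2 + 3 * c ^ 2 * y + c ^ 3
  binomial = solve 2 (λ c y → (c :+ y) :^ 3
                 := con 1 :* y :^ 3 :+ con 3 :* c :* y :^ 2 :+ con 3 :* c :^ 2 :* y :+ c :^ 3) refl

∑∑-cube : ∀ {n₁ n₂} (N : ℕ) (a : Fin n₁ → ℕ) (b : Fin n₂ → ℕ) →
  ∑[ i < n₁ ] ∑[ j < n₂ ] ((N * a i + b j) ^ 3)
    ≡ n₂ * N ^ 3 * ∑[ i < n₁ ] (a i ^ 3) + 3 * N ^ 2 * sum b * ∑[ i < n₁ ] (a i ^ 2)
      + 3 * N * ∑[ j < n₂ ] (b j ^ 2) * sum a + n₁ * ∑[ j < n₂ ] (b j ^ 3)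
∑∑-cube {n₁} {n₂} N a b = begin
  ∑[ i < n₁ ] ∑[ j < n₂ ] ((N * a i + b j) ^ 3)
    ≡⟨ sum-cong-≗ (λ i → trans (∑-shifted-cube (N * a i) b) (regroup (a i) B₁ B₂ B₃)) ⟩
  ∑[ i < n₁ ] (n₂ * N ^ 3 * a i ^ 3 + 3 * N ^ 2 * B₁ * a i ^ 2 + 3 * N * B₂ * a i + B₃)
    ≡⟨ ∑-cubic a (n₂ * N ^ 3) (3 * N ^ 2 * B₁) (3 * N * B₂) B₃ ⟩
  n₂ * N ^ 3 * ∑[ i < n₁ ] (a i ^ 3) + 3 * N ^ 2 * B₁ * ∑[ i < n₁ ] (a i ^ 2)
    + 3 * N * B₂ * sum a + n₁ * B₃ ∎
  where
  B₁ B₂ B₃ : ℕ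
  B₁ = sum b
  B₂ = ∑[ j < n₂ ] (b j ^ 2)
  B₃ = ∑[ j < n₂ ] (b j ^ 3)
  open +-*-Solver
  regroup : ∀ x B₁ B₂ B₃ →
    1 * B₃ + 3 * (N * x) * B₂ + 3 * (N * x) ^ 2 * B₁ + n₂ * (N * x) ^ 3
      ≡ n₂ * N ^ 3 * x ^ 3 + 3 * N ^ 2 * B₁ * x ^ 2 + 3 * N * B₂ * x + B₃
  regroup = solve 6 (λ N n₂ x B₁ B₂ B₃ →
      con 1 :* B₃ :+ con 3 :* (N :* x) :* B₂ :+ con 3 :* (N :* x) :^ 2 :* B₁ :+ n₂ :* (N :* x) :^ 3
    := n₂ :* N :^ 3 :* x :^ 3 :+ con 3 :* N :^ 2 :* B₁ :* x :^ 2 :+ con 3 :* N :* B₂ :* x :+ B₃)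
    refl N n₂

∑-splitAt : ∀ m {n} (h : Fin m ⊎ Fin n → ℕ) →
  ∑[ x < m + n ] h (splitAt m x) ≡ ∑[ i < m ] h (inj₁ i) + ∑[ j < n ] h (inj₂ j)
∑-splitAt zero    h = refl
∑-splitAt (suc m) h = begin
  h (inj₁ zero) + ∑[ x < m + _ ] h (map₁ suc (splitAt m x))
    ≡⟨ cong (h (inj₁ zero) +_) (∑-splitAt m (h ∘ map₁ suc)) ⟩
  h (inj₁ zero) + (∑[ i < m ] h (inj₁ (suc i)) + ∑[ j < _ ] h (inj₂ j))
    ≡⟨ sym (+-assoc (h (inj₁ zero)) _ _) ⟩
  h (inj₁ zero) + ∑[ i < m ] h (inj₁ (suc i)) + ∑[ j < _ ] h (inj₂ j) ∎

-- For suc m, remQuot unfolds to a case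
-- split on splitAt n: the first n indices form the fibre over zero.
∑-remQuot : ∀ m n (g : Fin m × Fin n → ℕ) →
  ∑[ x < m * n ] g (remQuot {m} n x) ≡ ∑[ i < m ] ∑[ j < n ] g (i , j)
∑-remQuot zero    n g = refl
∑-remQuot (suc m) n g = begin
  ∑[ x < suc m * n ] g (remQuot {suc m} n x)
    ≡⟨ ∑-splitAt n (g ∘ swap ∘ [ (_, zero) , map₂ suc ∘ quotRem {m} n ]′) ⟩
  ∑[ j < n ] g (zero , j) + ∑[ y < m * n ] g (suc (quotient n y) , remainder {m} n y)
    ≡⟨ cong (∑[ j < n ] g (zero , j) +_) (∑-remQuot m n (λ (i , j) → g (suc i , j))) ⟩
  ∑[ i < suc m ] ∑[ j < n ] g (i , j) ∎

deg≡∑ : ∀ {n} (G : Graph n) u → deg G u ≡ ∑[ v < n ] b2n (adj G u v)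
deg≡∑ G u = Σv≡∑ (λ v → b2n (adj G u v))

adj-split : ∀ {n} (G : Graph n) (u v : Fin n) →
  b2n (adj G u v) ≡ b2n (⌊ u <? v ⌋ ∧ adj G u v) + b2n (⌊ v <? u ⌋ ∧ adj G v u)
adj-split G u v rewrite symm G v u with adj G u v in uv | u <? v | v <? u
... | false | yes _  | yes _  = refl
... | false | yes _  | no _   = refl
... | false | no _   | yes _  = refl
... | false | no _   | no _   = refl
... | true  | yes p  | yes q  = ⊥-elim (<-asym p q)
... | true  | yes _  | no _   = refl
... | true  | no _   | yes _  = refl
... | true  | no u≮v | no v≮u with <-cmp u v
...   | tri< u<v _ _    = ⊥-elim (u≮v u<v)
...   | tri> _ _ v<u    = ⊥-elim (v≮u v<u)
...   | tri≈ _ refl _ with () ← trans (sym uv) (irrefl G u)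

handshake : ∀ {n} (G : Graph n) → ∑[ u < n ] deg G u ≡ 2 * edges G
handshake {n} G = begin
  ∑[ u < n ] deg G u
    ≡⟨ sum-cong-≗ (λ u → trans (deg≡∑ G u) (sum-cong-≗ (adj-split G u))) ⟩
  ∑[ u < n ] ∑[ v < n ] (e u v + e v u)
    ≡⟨ sum-cong-≗ (λ u → ∑-distrib-+ (e u) (λ v → e v u)) ⟩
  ∑[ u < n ] (sum (e u) + ∑[ v < n ] e v u)
    ≡⟨ ∑-distrib-+ (λ u → sum (e u)) (λ u → ∑[ v < n ] e v u) ⟩
  E + ∑[ u < n ] ∑[ v < n ] e v u
    ≡⟨ cong (E +_) (sym (∑-comm e)) ⟩
  E + E
    ≡⟨ cong (E +_) (sym (+-identityʳ E)) ⟩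
  2 * E
    ≡⟨ cong (2 *_) (sym edges≡E) ⟩
  2 * edges G ∎
  where
  e : Fin n → Fin n → ℕ
  e u v = b2n (⌊ u <? v ⌋ ∧ adj G u v)
  E : ℕ
  E = ∑[ u < n ] sum (e u)
  edges≡E : edges G ≡ E
  edges≡E = trans (Σv≡∑ (λ u → Σv (e u))) (sum-cong-≗ (λ u → Σv≡∑ (e u)))

module _ {n₁ n₂} (G₁ : Graph n₁) (G₂ : Graph n₂) where

  fibre-degree : ∀ u₁ u₂ i →
    ∑[ j < n₂ ] b2n (compAdj G₁ G₂ (u₁ , u₂) (i , j))
      ≡ n₂ * b2n (adj G₁ u₁ i) + b2n ⌊ u₁ ≟ i ⌋ * deg G₂ u₂
  fibre-degree u₁ u₂ i with u₁ ≟ i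
  ... | yes refl rewrite irrefl G₁ u₁ = begin
    ∑[ j < n₂ ] b2n (adj G₂ u₂ j)   ≡⟨ sym (deg≡∑ G₂ u₂) ⟩
    deg G₂ u₂                       ≡⟨ sym (*-identityˡ (deg G₂ u₂)) ⟩
    1 * deg G₂ u₂                   ≡⟨ cong (_+ 1 * deg G₂ u₂) (sym (*-zeroʳ n₂)) ⟩
    n₂ * 0 + 1 * deg G₂ u₂          ∎
  ... | no _ = begin
    ∑[ j < n₂ ] b2n (adj G₁ u₁ i ∨ false)  ≡⟨ ∑-const n₂ _ ⟩
    n₂ * b2n (adj G₁ u₁ i ∨ false)         ≡⟨ cong (λ b → n₂ * b2n b) (∨-identityʳ (adj G₁ u₁ i)) ⟩
    n₂ * b2n (adj G₁ u₁ i)                 ≡⟨ sym (+-identityʳ _) ⟩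
    n₂ * b2n (adj G₁ u₁ i) + 0             ∎

  deg-composition : ∀ x →
    deg (G₁ [ G₂ ]) x ≡ n₂ * deg G₁ (quotient n₂ x) + deg G₂ (remainder {n₁} n₂ x)
  deg-composition x = begin
    deg (G₁ [ G₂ ]) x
      ≡⟨ Σv≡∑ (λ y → b2n (compAdj G₁ G₂ (u₁ , u₂) (remQuot {n₁} n₂ y))) ⟩
    ∑[ y < n₁ * n₂ ] b2n (compAdj G₁ G₂ (u₁ , u₂) (remQuot {n₁} n₂ y))
      ≡⟨ ∑-remQuot n₁ n₂ (λ p → b2n (compAdj G₁ G₂ (u₁ , u₂) p)) ⟩
    ∑[ i < n₁ ] ∑[ j < n₂ ] b2n (compAdj G₁ G₂ (u₁ , u₂) (i , j))
      ≡⟨ sum-cong-≗ (fibre-degree u₁ u₂) ⟩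
    ∑[ i < n₁ ] (n₂ * b2n (adj G₁ u₁ i) + b2n ⌊ u₁ ≟ i ⌋ * deg G₂ u₂)
      ≡⟨ ∑-distrib-+ (λ i → n₂ * b2n (adj G₁ u₁ i)) (λ i → b2n ⌊ u₁ ≟ i ⌋ * deg G₂ u₂) ⟩
    ∑[ i < n₁ ] (n₂ * b2n (adj G₁ u₁ i)) + ∑[ i < n₁ ] (b2n ⌊ u₁ ≟ i ⌋ * deg G₂ u₂)
      ≡⟨ cong₂ _+_ (sym (*-distribˡ-sum n₂ (λ i → b2n (adj G₁ u₁ i)))) (∑-delta u₁ (deg G₂ u₂)) ⟩
    n₂ * ∑[ i < n₁ ] b2n (adj G₁ u₁ i) + deg G₂ u₂
      ≡⟨ cong (λ d → n₂ * d + deg G₂ u₂) (sym (deg≡∑ G₁ u₁)) ⟩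
    n₂ * deg G₁ u₁ + deg G₂ u₂ ∎
    where
    u₁ : Fin n₁
    u₁ = quotient n₂ x
    u₂ : Fin n₂
    u₂ = remainder {n₁} n₂ x

collect : ∀ n₁ n₂ F₁ F₂ M₁ M₂ m₁ m₂ →
  n₂ * n₂ ^ 3 * F₁ + 3 * n₂ ^ 2 * (2 * m₂) * M₁ + 3 * n₂ * M₂ * (2 * m₁) + n₁ * F₂
    ≡ n₂ ^ 4 * F₁ + n₁ * F₂ + 6 * n₂ ^ 2 * m₂ * M₁ + 6 * n₂ * m₁ * M₂
collect = solve 8 (λ n₁ n₂ F₁ F₂ M₁ M₂ m₁ m₂ →
    n₂ :* n₂ :^ 3 :* F₁ :+ con 3 :* n₂ :^ 2 :* (con 2 :* m₂) :* M₁
      :+ con 3 :* n₂ :* M₂ :* (con 2 :* m₁) :+ n₁ :* F₂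
  := n₂ :^ 4 :* F₁ :+ n₁ :* F₂ :+ con 6 :* n₂ :^ 2 :* m₂ :* M₁ :+ con 6 :* n₂ :* m₁ :* M₂) refl
  where open +-*-Solver

theorem5 : ∀ {n₁ n₂} (G₁ : Graph n₁) (G₂ : Graph n₂) →
    Connected G₁ → Connected G₂ →
    F (G₁ [ G₂ ]) ≡ n₂ ^ 4 * F G₁ + n₁ * F G₂
                      + 6 * n₂ ^ 2 * edges G₂ * M₁ G₁
                      + 6 * n₂ * edges G₁ * M₁ G₂
-- The rewrite presents F(Gᵢ) and M₁(Gᵢ) as sums over Fin nᵢ, the form in
-- which ∑∑-cube produces them.
theorem5 {n₁} {n₂} G₁ G₂ _ _
  rewrite Σv≡∑ (λ v → deg G₁ v ^ 3) | Σv≡∑ (λ v → deg G₂ v ^ 3)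
        | Σv≡∑ (λ v → deg G₁ v ^ 2) | Σv≡∑ (λ v → deg G₂ v ^ 2) = begin
  F (G₁ [ G₂ ])
    ≡⟨ Σv≡∑ (λ x → deg (G₁ [ G₂ ]) x ^ 3) ⟩
  ∑[ x < n₁ * n₂ ] (deg (G₁ [ G₂ ]) x ^ 3)
    ≡⟨ sum-cong-≗ (λ x → cong (_^ 3) (deg-composition G₁ G₂ x)) ⟩
  ∑[ x < n₁ * n₂ ] ((n₂ * d₁ (quotient n₂ x) + d₂ (remainder {n₁} n₂ x)) ^ 3)
    ≡⟨ ∑-remQuot n₁ n₂ (λ p → (n₂ * d₁ (proj₁ p) + d₂ (proj₂ p)) ^ 3) ⟩
  ∑[ i < n₁ ] ∑[ j < n₂ ] ((n₂ * d₁ i + d₂ j) ^ 3)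
    ≡⟨ ∑∑-cube n₂ d₁ d₂ ⟩
  n₂ * n₂ ^ 3 * ∑[ i < n₁ ] (d₁ i ^ 3) + 3 * n₂ ^ 2 * sum d₂ * ∑[ i < n₁ ] (d₁ i ^ 2)
    + 3 * n₂ * ∑[ j < n₂ ] (d₂ j ^ 2) * sum d₁ + n₁ * ∑[ j < n₂ ] (d₂ j ^ 3)
    ≡⟨ cong₂ (λ D₂ D₁ → n₂ * n₂ ^ 3 * F₁ + 3 * n₂ ^ 2 * D₂ * M₁′ + 3 * n₂ * M₂ * D₁ + n₁ * F₂)
             (handshake G₂) (handshake G₁) ⟩
  n₂ * n₂ ^ 3 * F₁ + 3 * n₂ ^ 2 * (2 * edges G₂) * M₁′ + 3 * n₂ * M₂ * (2 * edges G₁) + n₁ * F₂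
    ≡⟨ collect n₁ n₂ F₁ F₂ M₁′ M₂ (edges G₁) (edges G₂) ⟩
  n₂ ^ 4 * F₁ + n₁ * F₂ + 6 * n₂ ^ 2 * edges G₂ * M₁′ + 6 * n₂ * edges G₁ * M₂ ∎
  where
  d₁ : Fin n₁ → ℕ
  d₁ = deg G₁
  d₂ : Fin n₂ → ℕ
  d₂ = deg G₂
  F₁ M₁′ F₂ M₂ : ℕ
  F₁  = ∑[ i < n₁ ] (d₁ i ^ 3)
  M₁′ = ∑[ i < n₁ ] (d₁ i ^ 2)
  F₂  = ∑[ j < n₂ ] (d₂ j ^ 3)
  M₂  = ∑[ j < n₂ ] (d₂ j ^ 2)
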